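{- The order of a connected stepwise irregular tricyclic graph is an even integer. Moreover, for every positive even integer $n\notin\{2,4,6,8\}$ there exists a connected stepwise irregular tricyclic graph of order $n$.
   Context: All graphs are finite and simple. A graph $G$ is stepwise irregular (SI) if for every edge $uv\in E(G)$ one has $|d_G(u)-d_G(v)|=1$, where $d_G$ denotes degree. The order of a graph is its number of vertices. The cyclomatic number of a connected graph with $n$ vertices and $m$ edges is $\gamma=m-n+1$; a connected graph is tricyclic if $\gamma=3$. -}

module Defs where

open import Data.Nat using (ℕ; zero; suc; _+_; _∸_; _<_)
open import Data.Nat.Base using (∣_-_∣)
open import Data.Bool using (Bool; true; false)
open import Data.Fin using (Fin; toℕ)
open import Data.List using (List; []; _∷_; length; filter; allFin)
open import Data.Product using (Σ; _×_; _,_; ∃)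
open import Relation.Binary.PropositionalEquality using (_≡_)
open import Relation.Nullary using (¬_)
open import Data.Fin.Properties using () renaming (_<?_ to _<ᶠ?_)
open import Data.Nat.Properties using (_<?_)
open import Data.List using (concatMap; map)
open import Data.Product using (proj₁; proj₂)
open import Data.Bool using (T)
open import Relation.Nullary.Decidable using (Dec; yes; no)

record Graph (n : ℕ) : Set where
  field
    adj   : Fin n → Fin n → Bool
    sym   : ∀ u v → adj u v ≡ adj v u
    irrefl : ∀ v → adj v v ≡ false
open Graph public

order : ∀ {n} → Graph n → ℕ
order {n} _ = n

isTrue : (b : Bool) → Dec (T b)
isTrue true = yes _
isTrue false = no (λ ())

degree : ∀ {n} → Graph n → Fin n → ℕ
degree {n} G v = length (filter (λ u → isTrue (adj G v u)) (allFin n))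

edgeList : ∀ {n} → Graph n → List (Fin n × Fin n)
edgeList {n} G =
  filter (λ p → isTrue (adj G (proj₁ p) (proj₂ p)))
    (filter (λ p → proj₁ p <ᶠ? proj₂ p)
      (concatMap (λ u → map (λ v → (u , v)) (allFin n)) (allFin n)))

size : ∀ {n} → Graph n → ℕ
size G = length (edgeList G)

data Walk {n : ℕ} (G : Graph n) : Fin n → Fin n → Set where
  stay : ∀ v → Walk G v v
  step : ∀ u w v → adj G u w ≡ true → Walk G w v → Walk G u v

Connected : ∀ {n} → Graph n → Set
Connected {n} G = (u v : Fin n) → Walk G u v

StepwiseIrregular : ∀ {n} → Graph n → Set
StepwiseIrregular {n} G =
  ∀ (u v : Fin n) → adj G u v ≡ true → ∣ degree G u - degree G v ∣ ≡ 1

-- tricyclic: cyclomatic number m - n + 1 = 3 (i.e. m + 1 = n + 3; connected graphs have m + 1 ≥ n)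
Tricyclic : ∀ {n} → Graph n → Set
Tricyclic {n} G = size G + 1 ≡ n + 3

-- Writing the edge count as a double sum over ordered vertex pairs
-- gives a weighted handshake lemma: for any vertex weights w with
-- w u + w v = 1 on every edge uv, the size equals Σ_u deg u · w u.  In a
-- stepwise irregular graph the endpoints of an edge have degrees at distance
-- one, so exactly one of them is even; taking w u = [deg u even] shows the
-- size is a sum of even numbers.  Tricyclicity says size = n + 2, so n is even.
--
-- Orders 10, 12 and 14
-- come from explicit graphs whose properties are checked by evaluation; the
-- graphs of orders 12 and 14 have a port (a leaf next to a degree-2 vertex),
-- and hanging two paths of length two at a port adds 4 vertices while keeping
-- connectivity, stepwise irregularity, tricyclicity and a port.

module Submission where

open import Defs
open import Data.Nat.Properties using (+-*-semiring)
open import Algebra.Properties.Semiring.Sum +-*-semiring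
  using (sum-syntax; sum-cong-≗; sum-replicate-zero; ∑-distrib-+; ∑-comm; *-distribʳ-sum)
open import Data.Bool using (Bool; true; false; _∧_)
open import Data.Bool.ListAction using (any)
open import Data.Bool.Properties using () renaming (_≟_ to _≟ᴮ_)
open import Data.Empty using (⊥-elim)
open import Data.Fin using (Fin; zero; suc; toℕ; opposite; #_)
open import Data.Fin.Properties using (<-cmp; all?; any?) renaming (_<?_ to _<ᶠ?_; _≟_ to _≟ᶠ_)
open import Data.List using (List; []; _∷_; [_]; _++_; length; filter; map; concat; concatMap; tabulate)
open import Data.List.Properties using (map-tabulate)
open import Data.Nat using (ℕ; zero; suc; _+_; _*_; _≟_; _≡ᵇ_)
open import Data.Nat.Base using (∣_-_∣)
open import Data.Nat.Divisibility using (_∣_; divides; _∣0; ∣-refl; ∣m∣n⇒∣m+n; ∣m+n∣m⇒∣n)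
open import Data.Nat.Properties
  using (+-assoc; +-comm; +-identityʳ; *-identityʳ; *-zeroʳ; *-distribˡ-+; *-distribʳ-+; suc-injective)
open import Data.Product using (_×_; ∃; _,_; proj₁; proj₂)
open import Data.Unit using (⊤; tt)
open import Function using (id; _∘_)
open import Relation.Binary using (tri<; tri≈; tri>)
open import Relation.Binary.PropositionalEquality
  using (_≡_; _≢_; refl; cong; cong₂; trans; subst; module ≡-Reasoning) renaming (sym to ≡-sym)
open import Relation.Nullary using (does; Dec; yes; no; ¬_)
open import Relation.Nullary.Decidable using (dec-true; dec-false; from-yes; _×-dec_; _→-dec_)
open import Relation.Unary using (Pred; Decidable)

indicator : Bool → ℕ
indicator true  = 1
indicator false = 0

tally : ∀ {a} {A : Set a} → (A → Bool) → List A → ℕ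
tally f []       = 0
tally f (x ∷ xs) = indicator (f x) + tally f xs

module _ {a} {A : Set a} where

  length-filter : ∀ (f : A → Bool) xs → length (filter (λ x → isTrue (f x)) xs) ≡ tally f xs
  length-filter f [] = refl
  length-filter f (x ∷ xs) with f x
  ... | true  = cong suc (length-filter f xs)
  ... | false = length-filter f xs

  tally-filter : ∀ {p} {P : Pred A p} (P? : Decidable P) f xs →
                 tally f (filter P? xs) ≡ tally (λ x → does (P? x) ∧ f x) xs
  tally-filter P? f [] = refl
  tally-filter P? f (x ∷ xs) with does (P? x)
  ... | true  = cong (indicator (f x) +_) (tally-filter P? f xs)
  ... | false = tally-filter P? f xs

  tally-++ : ∀ (f : A → Bool) xs ys → tally f (xs ++ ys) ≡ tally f xs + tally f ys
  tally-++ f [] ys = refl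
  tally-++ f (x ∷ xs) ys =
    trans (cong (indicator (f x) +_) (tally-++ f xs ys)) (≡-sym (+-assoc (indicator (f x)) _ _))

  tally-tabulate : ∀ (f : A → Bool) n (h : Fin n → A) →
                   tally f (tabulate h) ≡ ∑[ i < n ] indicator (f (h i))
  tally-tabulate f zero    h = refl
  tally-tabulate f (suc n) h = cong (indicator (f (h zero)) +_) (tally-tabulate f n (h ∘ suc))

  tally-concat : ∀ (f : A → Bool) n (g : Fin n → List A) →
                 tally f (concat (tabulate g)) ≡ ∑[ i < n ] tally f (g i)
  tally-concat f zero    g = refl
  tally-concat f (suc n) g =
    trans (tally-++ f (g zero) _) (cong (tally f (g zero) +_) (tally-concat f n (g ∘ suc)))

∑-even : ∀ n (f : Fin n → ℕ) → (∀ i → 2 ∣ f i) → 2 ∣ ∑[ i < n ] f i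
∑-even zero    f even = 2 ∣0
∑-even (suc n) f even = ∣m∣n⇒∣m+n (even zero) (∑-even n (f ∘ suc) (even ∘ suc))

module _ {n : ℕ} (G : Graph n) where

  forwardEdge : Fin n → Fin n → Bool
  forwardEdge u v = does (u <ᶠ? v) ∧ adj G u v

  degree-as-sum : ∀ u → degree G u ≡ ∑[ v < n ] indicator (adj G u v)
  degree-as-sum u = trans (length-filter (adj G u) (tabulate id)) (tally-tabulate (adj G u) n id)

  size-as-sum : size G ≡ ∑[ u < n ] ∑[ v < n ] indicator (forwardEdge u v)
  size-as-sum = begin
      size G
    ≡⟨ length-filter isEdge (filter (λ p → proj₁ p <ᶠ? proj₂ p) pairs) ⟩
      tally isEdge (filter (λ p → proj₁ p <ᶠ? proj₂ p) pairs)
    ≡⟨ tally-filter (λ p → proj₁ p <ᶠ? proj₂ p) isEdge pairs ⟩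
      tally isForward pairs
    ≡⟨ cong (tally isForward ∘ concat) (map-tabulate id row) ⟩
      tally isForward (concat (tabulate row))
    ≡⟨ tally-concat isForward n row ⟩
      ∑[ u < n ] tally isForward (row u)
    ≡⟨ sum-cong-≗ (λ u → cong (tally isForward) (map-tabulate id (u ,_))) ⟩
      ∑[ u < n ] tally isForward (tabulate (u ,_))
    ≡⟨ sum-cong-≗ (λ u → tally-tabulate isForward n (u ,_)) ⟩
      ∑[ u < n ] ∑[ v < n ] indicator (forwardEdge u v) ∎
    where
    open ≡-Reasoning
    row : Fin n → List (Fin n × Fin n)
    row u = map (u ,_) (tabulate id)
    pairs : List (Fin n × Fin n)
    pairs = concatMap row (tabulate id)
    isEdge isForward : Fin n × Fin n → Bool
    isEdge (u , v) = adj G u v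
    isForward (u , v) = forwardEdge u v

  forward-symmetric : ∀ u v → indicator (forwardEdge u v) + indicator (forwardEdge v u) ≡ indicator (adj G u v)
  forward-symmetric u v with <-cmp u v
  ... | tri< u<v _ v≮u rewrite dec-true (u <ᶠ? v) u<v | dec-false (v <ᶠ? u) v≮u = +-identityʳ _
  ... | tri≈ u≮u refl _ rewrite dec-false (u <ᶠ? u) u≮u | irrefl G u = refl
  ... | tri> u≮v _ v<u rewrite dec-false (u <ᶠ? v) u≮v | dec-true (v <ᶠ? u) v<u | Graph.sym G u v = refl

  -- Weighted handshake lemma: summing w u + w v over the edges uv counts
  -- every vertex weight once per incident edge.
  weighted-handshake : ∀ (w : Fin n → ℕ) →
    ∑[ u < n ] ∑[ v < n ] (indicator (forwardEdge u v) * (w u + w v)) ≡ ∑[ u < n ] (degree G u * w u)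
  weighted-handshake w = begin
      ∑[ u < n ] ∑[ v < n ] (e u v * (w u + w v))
    ≡⟨ sum-cong-≗ (λ u → sum-cong-≗ (λ v → *-distribˡ-+ (e u v) (w u) (w v))) ⟩
      ∑[ u < n ] ∑[ v < n ] (e u v * w u + e u v * w v)
    ≡⟨ sum-cong-≗ (λ u → ∑-distrib-+ (λ v → e u v * w u) (λ v → e u v * w v)) ⟩
      ∑[ u < n ] (∑[ v < n ] (e u v * w u) + ∑[ v < n ] (e u v * w v))
    ≡⟨ ∑-distrib-+ (λ u → ∑[ v < n ] (e u v * w u)) (λ u → ∑[ v < n ] (e u v * w v)) ⟩
      ∑[ u < n ] ∑[ v < n ] (e u v * w u) + ∑[ u < n ] ∑[ v < n ] (e u v * w v)
    ≡⟨ cong (∑[ u < n ] ∑[ v < n ] (e u v * w u) +_) (∑-comm (λ u v → e u v * w v)) ⟩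
      ∑[ u < n ] ∑[ v < n ] (e u v * w u) + ∑[ u < n ] ∑[ v < n ] (e v u * w u)
    ≡⟨ ≡-sym (∑-distrib-+ (λ u → ∑[ v < n ] (e u v * w u)) (λ u → ∑[ v < n ] (e v u * w u))) ⟩
      ∑[ u < n ] (∑[ v < n ] (e u v * w u) + ∑[ v < n ] (e v u * w u))
    ≡⟨ sum-cong-≗ (λ u → ≡-sym (∑-distrib-+ (λ v → e u v * w u) (λ v → e v u * w u))) ⟩
      ∑[ u < n ] ∑[ v < n ] (e u v * w u + e v u * w u)
    ≡⟨ sum-cong-≗ (λ u → sum-cong-≗ (λ v → incident u v)) ⟩
      ∑[ u < n ] ∑[ v < n ] (indicator (adj G u v) * w u)
    ≡⟨ sum-cong-≗ (λ u → ≡-sym (*-distribʳ-sum (w u) (λ v → indicator (adj G u v)))) ⟩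
      ∑[ u < n ] ((∑[ v < n ] indicator (adj G u v)) * w u)
    ≡⟨ sum-cong-≗ (λ u → cong (_* w u) (≡-sym (degree-as-sum u))) ⟩
      ∑[ u < n ] (degree G u * w u) ∎
    where
    open ≡-Reasoning
    e : Fin n → Fin n → ℕ
    e u v = indicator (forwardEdge u v)
    incident : ∀ u v → e u v * w u + e v u * w u ≡ indicator (adj G u v) * w u
    incident u v = trans (≡-sym (*-distribʳ-+ (w u) (e u v) (e v u))) (cong (_* w u) (forward-symmetric u v))

  size-by-weights : ∀ (w : Fin n → ℕ) → (∀ u v → adj G u v ≡ true → w u + w v ≡ 1) →
                    size G ≡ ∑[ u < n ] (degree G u * w u)
  size-by-weights w split = begin
      size G
    ≡⟨ size-as-sum ⟩
      ∑[ u < n ] ∑[ v < n ] indicator (forwardEdge u v)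
    ≡⟨ sum-cong-≗ (λ u → sum-cong-≗ (λ v → unit-on-edges (does (u <ᶠ? v)) (adj G u v) (split u v))) ⟩
      ∑[ u < n ] ∑[ v < n ] (indicator (forwardEdge u v) * (w u + w v))
    ≡⟨ weighted-handshake w ⟩
      ∑[ u < n ] (degree G u * w u) ∎
    where
    open ≡-Reasoning
    unit-on-edges : ∀ b c {x} → (c ≡ true → x ≡ 1) → indicator (b ∧ c) ≡ indicator (b ∧ c) * x
    unit-on-edges false c     h = refl
    unit-on-edges true  false h = refl
    unit-on-edges true  true  h rewrite h refl = refl

isEven : ℕ → Bool
isEven zero          = true
isEven (suc zero)    = false
isEven (suc (suc n)) = isEven n

isEven⇒2∣ : ∀ n → isEven n ≡ true → 2 ∣ n
isEven⇒2∣ zero          _    = 2 ∣0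
isEven⇒2∣ (suc (suc n)) even = ∣m∣n⇒∣m+n (∣-refl {2}) (isEven⇒2∣ n even)

distance-one-parity : ∀ x y → ∣ x - y ∣ ≡ 1 → indicator (isEven x) + indicator (isEven y) ≡ 1
distance-one-parity zero                zero                ()
distance-one-parity zero                (suc zero)          _ = refl
distance-one-parity zero                (suc (suc y))       ()
distance-one-parity (suc zero)          zero                _ = refl
distance-one-parity (suc zero)          (suc zero)          ()
distance-one-parity (suc zero)          (suc (suc zero))    _ = refl
distance-one-parity (suc zero)          (suc (suc (suc y))) ()
distance-one-parity (suc (suc x))       zero                ()
distance-one-parity (suc (suc zero))    (suc zero)          _ = refl
distance-one-parity (suc (suc (suc x))) (suc zero)          ()
distance-one-parity (suc (suc x))       (suc (suc y))       h = distance-one-parity x y h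

2∣even-part : ∀ d → 2 ∣ d * indicator (isEven d)
2∣even-part d with isEven d in even
... | true  = subst (2 ∣_) (≡-sym (*-identityʳ d)) (isEven⇒2∣ d even)
... | false = subst (2 ∣_) (≡-sym (*-zeroʳ d)) (2 ∣0)

-- In a stepwise irregular graph every edge has exactly one endpoint of even
-- degree, so the size is the sum of the even degrees, hence even.
stepwiseIrregular-size-even : ∀ {n} (G : Graph n) → StepwiseIrregular G → 2 ∣ size G
stepwiseIrregular-size-even {n} G si =
  subst (2 ∣_) (≡-sym (size-by-weights G evenDegree (λ u v uv → distance-one-parity (degree G u) (degree G v) (si u v uv))))
        (∑-even n (λ u → degree G u * evenDegree u) (λ u → 2∣even-part (degree G u)))
  where
  evenDegree : Fin n → ℕ
  evenDegree u = indicator (isEven (degree G u))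

tricyclic-size : ∀ {n} (G : Graph n) → Tricyclic G → size G ≡ 2 + n
tricyclic-size {n} G tri = suc-injective (begin
    suc (size G) ≡⟨ +-comm 1 (size G) ⟩
    size G + 1   ≡⟨ tri ⟩
    n + 3        ≡⟨ +-comm n 3 ⟩
    3 + n        ∎)
  where open ≡-Reasoning

order-even : ∀ n (G : Graph n) → Connected G → StepwiseIrregular G → Tricyclic G → 2 ∣ n
order-even n G _ si tri =
  ∣m+n∣m⇒∣n (subst (2 ∣_) (tricyclic-size G tri) (stepwiseIrregular-size-even G si)) (∣-refl {2})

addVertex : ∀ {n} → Graph n → (Fin n → Bool) → Graph (suc n)
addVertex {n} G N = record { adj = adj′ ; sym = sym′ ; irrefl = irrefl′ }
  where
  adj′ : Fin (suc n) → Fin (suc n) → Bool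
  adj′ zero    zero    = false
  adj′ zero    (suc v) = N v
  adj′ (suc u) zero    = N u
  adj′ (suc u) (suc v) = adj G u v
  sym′ : ∀ u v → adj′ u v ≡ adj′ v u
  sym′ zero    zero    = refl
  sym′ zero    (suc v) = refl
  sym′ (suc u) zero    = refl
  sym′ (suc u) (suc v) = Graph.sym G u v
  irrefl′ : ∀ v → adj′ v v ≡ false
  irrefl′ zero    = refl
  irrefl′ (suc v) = irrefl G v

_++ʷ_ : ∀ {n} {G : Graph n} {u v w} → Walk G u v → Walk G v w → Walk G u w
stay _         ++ʷ q = q
step u x v e p ++ʷ q = step u x _ e (p ++ʷ q)

module _ {n : ℕ} (G : Graph n) (N : Fin n → Bool) where

  degree-new : degree (addVertex G N) zero ≡ ∑[ v < n ] indicator (N v)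
  degree-new = degree-as-sum (addVertex G N) zero

  degree-old : ∀ v → degree (addVertex G N) (suc v) ≡ indicator (N v) + degree G v
  degree-old v = trans (degree-as-sum (addVertex G N) (suc v)) (cong (indicator (N v) +_) (≡-sym (degree-as-sum G v)))

  size-addVertex : size (addVertex G N) ≡ ∑[ v < n ] indicator (N v) + size G
  size-addVertex = trans (size-as-sum (addVertex G N)) (cong (∑[ v < n ] indicator (N v) +_) (≡-sym (size-as-sum G)))

  lift : ∀ {u v} → Walk G u v → Walk (addVertex G N) (suc u) (suc v)
  lift (stay v)         = stay (suc v)
  lift (step u w v e p) = step (suc u) (suc w) (suc v) e (lift p)

  connected-addVertex : ∀ p → N p ≡ true → Connected G → Connected (addVertex G N)
  connected-addVertex p e conn zero    zero    = stay zero
  connected-addVertex p e conn zero    (suc v) = step zero (suc p) (suc v) e (lift (conn p v))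
  connected-addVertex p e conn (suc u) zero    = lift (conn u p) ++ʷ step (suc p) zero zero e (stay zero)
  connected-addVertex p e conn (suc u) (suc v) = lift (conn u v)

only : ∀ {n} → Fin n → Fin n → Bool
only p v = does (v ≟ᶠ p)

only-self : ∀ {n} (p : Fin n) → only p p ≡ true
only-self p = dec-true (p ≟ᶠ p) refl

only-other : ∀ {n} {p w : Fin n} → ¬ w ≡ p → only p w ≡ false
only-other {p = p} {w} w≢p = dec-false (w ≟ᶠ p) w≢p

only⇒≡ : ∀ {n} {p w : Fin n} → only p w ≡ true → w ≡ p
only⇒≡ {p = p} {w} e with w ≟ᶠ p
... | yes w≡p = w≡p

count-only : ∀ {n} (p : Fin n) → ∑[ v < n ] indicator (only p v) ≡ 1
count-only {suc n} zero    = cong suc (sum-replicate-zero n)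
count-only {suc n} (suc p) = count-only p

attachLeaf : ∀ {n} → Graph n → Fin n → Graph (suc n)
attachLeaf G p = addVertex G (only p)

module _ {n : ℕ} (G : Graph n) (p : Fin n) where

  leaf-degree : degree (attachLeaf G p) zero ≡ 1
  leaf-degree = trans (degree-new G (only p)) (count-only p)

  size-attachLeaf : size (attachLeaf G p) ≡ suc (size G)
  size-attachLeaf = trans (size-addVertex G (only p)) (cong (_+ size G) (count-only p))

  connected-attachLeaf : Connected G → Connected (attachLeaf G p)
  connected-attachLeaf = connected-addVertex G (only p) p (only-self p)

record PortedGraph (n : ℕ) : Set where
  field
    graph          : Graph n
    connected      : Connected graph
    stepwise       : StepwiseIrregular graph
    tricyclic      : Tricyclic graph
    port           : Fin n
    port-leaf      : degree graph port ≡ 1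
    port-neighbour : ∀ w → adj graph port w ≡ true → degree graph w ≡ 2

-- Hanging two paths of length two at the port keeps all three properties
-- (the port gets degree 3 next to degree-2 vertices, and the cyclomatic
-- number is unchanged), and the end of the second path is a new port.
module Extension {n : ℕ} (P : PortedGraph n) where
  open PortedGraph P

  -- Indices: 0, 1 second path (end, middle); 2, 3 first path (end, middle);
  -- 4 + w the old vertex w.
  G₁ : Graph (1 + n)
  G₁ = attachLeaf graph port
  G₂ : Graph (2 + n)
  G₂ = attachLeaf G₁ zero
  G₃ : Graph (3 + n)
  G₃ = attachLeaf G₂ (suc (suc port))
  extended : Graph (4 + n)
  extended = attachLeaf G₃ zero

  old : Fin n → Fin (4 + n)
  old w = suc (suc (suc (suc w)))

  degree-of-old : ∀ w → degree extended (old w) ≡ indicator (only port w) + (indicator (only port w) + degree graph w)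
  degree-of-old w =
    trans (degree-old G₃ (only zero) (suc (suc (suc w))))
   (trans (degree-old G₂ (only (suc (suc port))) (suc (suc w)))
   (cong (indicator (only port w) +_)
     (trans (degree-old G₁ (only zero) (suc w)) (degree-old graph (only port) w))))

  degree-port : degree extended (old port) ≡ 3
  degree-port = trans (degree-of-old port)
    (cong₂ (λ b d → indicator b + (indicator b + d)) (only-self port) port-leaf)

  degree-unchanged : ∀ w → ¬ w ≡ port → degree extended (old w) ≡ degree graph w
  degree-unchanged w w≢p = trans (degree-of-old w)
    (cong (λ b → indicator b + (indicator b + degree graph w)) (only-other w≢p))

  degree-0 : degree extended zero ≡ 1
  degree-0 = leaf-degree G₃ zero
  degree-1 : degree extended (suc zero) ≡ 2
  degree-1 = trans (degree-old G₃ (only zero) zero) (cong suc (leaf-degree G₂ (suc (suc port))))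
  degree-2 : degree extended (suc (suc zero)) ≡ 1
  degree-2 = trans (degree-old G₃ (only zero) (suc zero))
    (trans (degree-old G₂ (only (suc (suc port))) zero) (leaf-degree G₁ zero))
  degree-3 : degree extended (suc (suc (suc zero))) ≡ 2
  degree-3 = trans (degree-old G₃ (only zero) (suc (suc zero)))
    (trans (degree-old G₂ (only (suc (suc port))) (suc zero))
    (trans (degree-old G₁ (only zero) zero) (cong suc (leaf-degree graph port))))

  -- an old edge: only the port changed degree, and its neighbours have degree 2
  stepwise-old : ∀ x y → adj graph x y ≡ true → Dec (x ≡ port) → Dec (y ≡ port) →
                 ∣ degree extended (old x) - degree extended (old y) ∣ ≡ 1
  stepwise-old x y e (yes refl) (yes refl) with () ← trans (≡-sym e) (irrefl graph port)
  stepwise-old x y e (yes refl) (no y≢p) = cong₂ ∣_-_∣ degree-port (trans (degree-unchanged y y≢p) (port-neighbour y e))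
  stepwise-old x y e (no x≢p) (yes refl) =
    cong₂ ∣_-_∣ (trans (degree-unchanged x x≢p) (port-neighbour x (trans (Graph.sym graph port x) e))) degree-port
  stepwise-old x y e (no x≢p) (no y≢p) = trans (cong₂ ∣_-_∣ (degree-unchanged x x≢p) (degree-unchanged y y≢p)) (stepwise x y e)

  stepwise-extended : StepwiseIrregular extended
  stepwise-extended zero (suc zero) _ = cong₂ ∣_-_∣ degree-0 degree-1
  stepwise-extended (suc zero) zero _ = cong₂ ∣_-_∣ degree-1 degree-0
  stepwise-extended (suc zero) (suc (suc (suc (suc w)))) e with refl ← only⇒≡ {w = w} e = cong₂ ∣_-_∣ degree-1 degree-port
  stepwise-extended (suc (suc (suc (suc w)))) (suc zero) e with refl ← only⇒≡ {w = w} e = cong₂ ∣_-_∣ degree-port degree-1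
  stepwise-extended (suc (suc zero)) (suc (suc (suc zero))) _ = cong₂ ∣_-_∣ degree-2 degree-3
  stepwise-extended (suc (suc (suc zero))) (suc (suc zero)) _ = cong₂ ∣_-_∣ degree-3 degree-2
  stepwise-extended (suc (suc (suc zero))) (suc (suc (suc (suc w)))) e with refl ← only⇒≡ {w = w} e = cong₂ ∣_-_∣ degree-3 degree-port
  stepwise-extended (suc (suc (suc (suc w)))) (suc (suc (suc zero))) e with refl ← only⇒≡ {w = w} e = cong₂ ∣_-_∣ degree-port degree-3
  stepwise-extended (suc (suc (suc (suc x)))) (suc (suc (suc (suc y)))) e = stepwise-old x y e (x ≟ᶠ port) (y ≟ᶠ port)

  size-extended : size extended ≡ 4 + size graph
  size-extended =
    trans (size-attachLeaf G₃ zero) (cong suc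
   (trans (size-attachLeaf G₂ (suc (suc port))) (cong suc
   (trans (size-attachLeaf G₁ zero) (cong suc (size-attachLeaf graph port))))))

  connected-extended : Connected extended
  connected-extended = connected-attachLeaf G₃ zero (connected-attachLeaf G₂ (suc (suc port))
    (connected-attachLeaf G₁ zero (connected-attachLeaf graph port connected)))

  port-neighbour-extended : ∀ w → adj extended zero w ≡ true → degree extended w ≡ 2
  port-neighbour-extended (suc zero) _ = degree-1

  extend : PortedGraph (4 + n)
  extend = record
    { graph          = extended
    ; connected      = connected-extended
    ; stepwise       = stepwise-extended
    ; tricyclic      = trans (cong (_+ 1) size-extended) (cong (4 +_) tricyclic)
    ; port           = zero
    ; port-leaf      = degree-0
    ; port-neighbour = port-neighbour-extended
    }

-- Stepwise irregularity and the port condition are decidable, so for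
-- concrete graphs they are established by evaluation.
stepwiseIrregular? : ∀ {n} (G : Graph n) → Dec (StepwiseIrregular G)
stepwiseIrregular? G =
  all? λ u → all? λ v → (adj G u v ≟ᴮ true) →-dec (∣ degree G u - degree G v ∣ ≟ 1)

portNeighbours? : ∀ {n} (G : Graph n) (p : Fin n) → Dec (∀ w → adj G p w ≡ true → degree G w ≡ 2)
portNeighbours? G p = all? λ w → (adj G p w ≟ᴮ true) →-dec (degree G w ≟ 2)

-- Vertices are created in the order 0, 1, 2, …; each new vertex comes with
-- the list of earlier vertices it is joined to.
data Recipe : ℕ → Set where
  start : Recipe 1
  _▷_   : ∀ {n} → Recipe n → List ℕ → Recipe (suc n)
infixl 4 _▷_

-- since new vertices are placed at index zero, index v holds the vertex
-- created as number label v
label : ∀ {n} → Fin n → ℕ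
label v = toℕ (opposite v)

-- the index of the vertex created as number k (opposite is an involution)
vertex : ∀ {n} → Fin n → Fin n
vertex = opposite

joinedTo : ∀ {n} → List ℕ → Fin n → Bool
joinedTo ks v = any (label v ≡ᵇ_) ks

singleton : Graph 1
singleton = record { adj = λ _ _ → false ; sym = λ _ _ → refl ; irrefl = λ _ → refl }

build : ∀ {n} → Recipe n → Graph n
build start    = singleton
build (r ▷ ks) = addVertex (build r) (joinedTo ks)

Anchored : ∀ {n} → Recipe n → Set
Anchored start    = ⊤
Anchored (_▷_ {n} r ks) = Anchored r × ∃ λ (v : Fin n) → joinedTo ks v ≡ true

anchored? : ∀ {n} (r : Recipe n) → Dec (Anchored r)
anchored? start    = yes tt
anchored? (_▷_ {n} r ks) = anchored? r ×-dec any? λ (v : Fin n) → joinedTo ks v ≟ᴮ true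

build-connected : ∀ {n} (r : Recipe n) → Anchored r → Connected (build r)
build-connected start    _             zero zero = stay zero
build-connected (r ▷ ks) (a , p , e) = connected-addVertex (build r) (joinedTo ks) p e (build-connected r a)

Realisable : ℕ → Set
Realisable n = ∃ λ (G : Graph n) → Connected G × StepwiseIrregular G × Tricyclic G

-- vertex 0 with a binary tree of depth two below it; vertices 7 and 8 join the
-- two pairs of sibling leaves and vertex 9 joins 7 and 8
base10 : Recipe 10
base10 = start ▷ [ 0 ] ▷ [ 0 ] ▷ [ 1 ] ▷ [ 1 ] ▷ [ 2 ] ▷ [ 2 ] ▷ 3 ∷ 4 ∷ [] ▷ 5 ∷ 6 ∷ [] ▷ 7 ∷ 8 ∷ []

realisable10 : Realisable 10
realisable10 = build base10 , build-connected base10 (from-yes (anchored? base10))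
             , from-yes (stepwiseIrregular? (build base10)) , refl

-- degree sequence 1,2,3,2,4,3,3,3,2,2,2,1; vertex 0 is a port
base12 : Recipe 12
base12 = start ▷ [ 0 ] ▷ [ 1 ] ▷ [ 2 ] ▷ [ 2 ] ▷ 3 ∷ 4 ∷ [] ▷ [ 4 ] ▷ [ 4 ] ▷ 5 ∷ 6 ∷ [] ▷ 6 ∷ 7 ∷ [] ▷ [ 7 ] ▷ [ 10 ]

ported12 : PortedGraph 12
ported12 = record
  { graph = build base12 ; connected = build-connected base12 (from-yes (anchored? base12))
  ; stepwise = from-yes (stepwiseIrregular? (build base12)) ; tricyclic = refl
  ; port = vertex (# 0) ; port-leaf = refl ; port-neighbour = from-yes (portNeighbours? (build base12) (vertex (# 0))) }

-- degree sequence 3,2,2,2,1,3,3,2,2,2,2,3,3,2; vertex 4 is a port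
base14 : Recipe 14
base14 = start ▷ [ 0 ] ▷ [ 0 ] ▷ [ 0 ] ▷ [ 1 ] ▷ [ 2 ] ▷ [ 3 ] ▷ [ 5 ] ▷ [ 5 ] ▷ [ 6 ] ▷ [ 6 ]
               ▷ 7 ∷ 9 ∷ [] ▷ 8 ∷ 10 ∷ [] ▷ 11 ∷ 12 ∷ []

ported14 : PortedGraph 14
ported14 = record
  { graph = build base14 ; connected = build-connected base14 (from-yes (anchored? base14))
  ; stepwise = from-yes (stepwiseIrregular? (build base14)) ; tricyclic = refl
  ; port = vertex (# 4) ; port-leaf = refl ; port-neighbour = from-yes (portNeighbours? (build base14) (vertex (# 4))) }

realisable : ∀ {n} → PortedGraph n → Realisable n
realisable P = graph , connected , stepwise , tricyclic
  where open PortedGraph P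

ported : ∀ j → PortedGraph (12 + j * 2)
ported zero          = ported12
ported (suc zero)    = ported14
ported (suc (suc j)) = Extension.extend (ported j)

realisable-even : ∀ n → 2 ∣ n → n ≢ 0 → n ≢ 2 → n ≢ 4 → n ≢ 6 → n ≢ 8 → Realisable n
realisable-even n (divides 0 n≡0) n≢0 _ _ _ _ = ⊥-elim (n≢0 n≡0)
realisable-even n (divides 1 n≡2) _ n≢2 _ _ _ = ⊥-elim (n≢2 n≡2)
realisable-even n (divides 2 n≡4) _ _ n≢4 _ _ = ⊥-elim (n≢4 n≡4)
realisable-even n (divides 3 n≡6) _ _ _ n≢6 _ = ⊥-elim (n≢6 n≡6)
realisable-even n (divides 4 n≡8) _ _ _ _ n≢8 = ⊥-elim (n≢8 n≡8)
realisable-even n (divides 5 refl) _ _ _ _ _ = realisable10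
realisable-even n (divides (suc (suc (suc (suc (suc (suc j)))))) refl) _ _ _ _ _ = realisable (ported j)

mainTheorem10 : ((n : ℕ) (G : Graph n) → Connected G → StepwiseIrregular G → Tricyclic G → 2 ∣ n)
    × ((n : ℕ) → 2 ∣ n → n ≢ 0 → n ≢ 2 → n ≢ 4 → n ≢ 6 → n ≢ 8 →
    ∃ λ (G : Graph n) → Connected G × StepwiseIrregular G × Tricyclic G)
mainTheorem10 = order-even , realisable-even
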